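{- Let $(G,D)$ be a standard pair and let $\overrightarrow{G}$ be any strong orientation of $G$. If $G$ is not a triangle, then $\theta(u,v)\le diam(\overrightarrow{G})-2$ for every $u\in V(G)\setminus D$ and every $v\in D$.
   Context: Graphs are finite, simple, undirected and connected. A graph is bridgeless if it has no edge whose removal disconnects it. A vertex $v$ is associated with an isolated triangle if there exist vertices $v_1,v_2$ with $d_G(v_1)=d_G(v_2)=2$ such that $vv_1v_2$ is a triangle. A pair $(G,D)$ is standard if $G$ is bridgeless, $D\subseteq V(G)$ is an independent dominating set of $G$, every vertex of $V(G)\setminus D$ is adjacent to exactly one vertex of $D$, and every vertex of $D$ is associated with an isolated triangle. For a strong orientation $\overrightarrow{G}$ (one in which every vertex can reach every other by a directed path), $\partial(u,v)$ is the length of a shortest directed $u$–$v$ path, $\theta(u,v)=\max\{\partial(u,v),\partial(v,u)\}$, and $diam(\overrightarrow{G})=\max_{u,v}\theta(u,v)$. -}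

module Defs where

open import Data.Nat using (ℕ; zero; suc; _+_; _≤_; _⊔_)
open import Data.Fin using (Fin)
open import Data.Bool using (Bool; true; false)
open import Data.List using (List; filter; length)
open import Data.List using () renaming (allFin to allFinL)
open import Data.Product using (Σ; _×_; _,_; ∃; ∃-syntax)
open import Data.Sum using (_⊎_)
open import Relation.Binary.PropositionalEquality using (_≡_; _≢_)
open import Relation.Nullary using (¬_)
open import Data.Bool using (T)
open import Data.Bool.Properties using (T?)

record Graph (n : ℕ) : Set where
  field
    adj     : Fin n → Fin n → Bool
    sym     : ∀ u v → adj u v ≡ adj v u
    irrefl  : ∀ u → adj u u ≡ false
open Graph public

Edge : ∀ {n} → Graph n → Fin n → Fin n → Set
Edge G u v = T (adj G u v)

degree : ∀ {n} → Graph n → Fin n → ℕ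
degree {n} G v = length (filter (λ w → T? (adj G v w)) (allFinL n))

data Walk {n : ℕ} (R : Fin n → Fin n → Set) : Fin n → Fin n → ℕ → Set where
  here : ∀ {u} → Walk R u u 0
  step : ∀ {u v w k} → R u v → Walk R v w k → Walk R u w (suc k)

Connected : ∀ {n} → Graph n → Set
Connected {n} G = ∀ (u v : Fin n) → ∃[ k ] Walk (Edge G) u v k

EdgeMinus : ∀ {n} → Graph n → Fin n → Fin n → Fin n → Fin n → Set
EdgeMinus G a b u v = Edge G u v × ¬ ((u ≡ a × v ≡ b) ⊎ (u ≡ b × v ≡ a))

Bridgeless : ∀ {n} → Graph n → Set
Bridgeless {n} G = ∀ a b → Edge G a b →
  ∀ (u v : Fin n) → ∃[ k ] Walk (EdgeMinus G a b) u v k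

Independent : ∀ {n} → Graph n → (Fin n → Set) → Set
Independent G D = ∀ u v → D u → D v → ¬ Edge G u v

UniqueDom : ∀ {n} → Graph n → (Fin n → Set) → Set
UniqueDom G D = ∀ u → ¬ D u →
  Σ _ λ d → D d × Edge G u d × (∀ d' → D d' → Edge G u d' → d' ≡ d)

Dominating : ∀ {n} → Graph n → (Fin n → Set) → Set
Dominating G D = ∀ u → D u ⊎ Σ _ λ d → D d × Edge G u d

IsolatedTriangleAt : ∀ {n} → Graph n → Fin n → Set
IsolatedTriangleAt G v = Σ _ λ v₁ → Σ _ λ v₂ →
  degree G v₁ ≡ 2 × degree G v₂ ≡ 2 ×
  Edge G v v₁ × Edge G v₁ v₂ × Edge G v v₂

-- standard pair (G , D)  (G connected is a standing assumption)
Standard : ∀ {n} → Graph n → (Fin n → Set) → Set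
Standard G D = Connected G × Bridgeless G × Independent G D ×
  Dominating G D × UniqueDom G D × (∀ v → D v → IsolatedTriangleAt G v)

IsTriangle : ∀ {n} → Graph n → Set
IsTriangle {n} G = n ≡ 3 × (∀ u v → u ≢ v → Edge G u v)

record Orientation {n : ℕ} (G : Graph n) : Set where
  field
    arc      : Fin n → Fin n → Bool
    arc⇒edge : ∀ u v → T (arc u v) → Edge G u v
    oneway   : ∀ u v → T (arc u v) → ¬ T (arc v u)
    covers   : ∀ u v → Edge G u v → T (arc u v) ⊎ T (arc v u)
open Orientation public

Arc : ∀ {n} {G : Graph n} → Orientation G → Fin n → Fin n → Set
Arc O u v = T (arc O u v)

Strong : ∀ {n} {G : Graph n} → Orientation G → Set
Strong {n} O = ∀ (u v : Fin n) → ∃[ k ] Walk (Arc O) u v k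

IsDist : ∀ {n} {G : Graph n} → Orientation G → Fin n → Fin n → ℕ → Set
IsDist O u v d = Walk (Arc O) u v d × (∀ k → Walk (Arc O) u v k → d ≤ k)

IsTheta : ∀ {n} {G : Graph n} → Orientation G → Fin n → Fin n → ℕ → Set
IsTheta O u v t = Σ ℕ λ d₁ → Σ ℕ λ d₂ →
  IsDist O u v d₁ × IsDist O v u d₂ × t ≡ d₁ ⊔ d₂

IsDiam : ∀ {n} {G : Graph n} → Orientation G → ℕ → Set
IsDiam {n} O m = (Σ (Fin n) λ x → Σ (Fin n) λ y → IsTheta O x y m) ×
  (∀ x y t → IsTheta O x y t → t ≤ m)

-- Let v ∈ D lie on the isolated triangle v v₁ v₂. As v₁ and v₂ have degree 2, a strong
-- orientation must turn it into a directed cycle v → a → b → v, and then every directed walk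
-- leaving a starts a → b → v, while every walk entering b ends v → a → b. So for z ∉ {a, b}
-- we get ∂(v,z) + 2 ≤ ∂(a,z) and ∂(z,v) + 2 ≤ ∂(z,b), whence θ(z,v) + 2 ≤ diam. For u ∈ {a, b},
-- θ(u,v) = 2, and diam ≥ 4 because G is not a triangle, so some z ∉ {v, a, b} exists and
-- 2 ≤ θ(z,v) ≤ diam − 2.

module Submission where

open import Defs
open import Data.Nat using (ℕ; _+_; _≤_)
open import Data.Fin using (Fin)
open import Relation.Nullary using (¬_)

open import Data.Bool using (T)
open import Data.Bool.Properties using (T?)
open import Data.Fin using (zero; suc; _≟_)
open import Data.Fin.Properties using (any?; injective⇒≤)
open import Data.List using (List; []; _∷_; allFin; filter; length; lookup)
open import Data.List.Membership.Propositional using (_∈_; _∉_)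
open import Data.List.Membership.Propositional.Properties using (∈-filter⁺; ∈-allFin)
open import Data.List.Relation.Unary.Any using (here; there; index)
import Data.List.Relation.Unary.Any as Any
open import Data.List.Relation.Unary.Any.Properties using (lookup-index)
open import Data.Nat using (zero; suc; _<_; _⊔_; z≤n; s≤s)
open import Data.Nat.Induction using (<-rec)
open import Data.Nat.Properties
  using (≤-trans; ≤-antisym; +-comm; +-monoˡ-≤; ⊔-lub; m≤m⊔n; m≤n⊔m; ≮⇒≥; <-irrefl; anyUpTo?)
open import Data.Product using (_×_; _,_; ∃; ∃-syntax; proj₂)
open import Data.Sum using (_⊎_; inj₁; inj₂; [_,_]′)
open import Function using (id; flip; _∘_)
open import Function.Definitions using (Injective)
open import Relation.Binary.PropositionalEquality using (_≡_; _≢_; refl; trans; cong; subst)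
  renaming (sym to ≡-sym)
open import Relation.Nullary using (Dec; yes; no; ¬?; contradiction)
open import Relation.Nullary.Decidable using (_×-dec_; decidable-stable)

private
  variable
    n k d t : ℕ
    A : Set
    x y z p q w : A
    R : Fin n → Fin n → Set

triple : A → A → A → Fin 3 → A
triple x y z zero = x
triple x y z (suc zero) = y
triple x y z (suc (suc zero)) = z

triple-injective : x ≢ y → x ≢ z → y ≢ z → Injective _≡_ _≡_ (triple x y z)
triple-injective _   _   _   {zero}             {zero}             _ = refl
triple-injective x≢y _   _   {zero}             {suc zero}         e = contradiction e x≢y
triple-injective _   x≢z _   {zero}             {suc (suc zero)}   e = contradiction e x≢z
triple-injective x≢y _   _   {suc zero}         {zero}             e = contradiction (≡-sym e) x≢y
triple-injective _   _   _   {suc zero}         {suc zero}         _ = refl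
triple-injective _   _   y≢z {suc zero}         {suc (suc zero)}   e = contradiction e y≢z
triple-injective _   x≢z _   {suc (suc zero)}   {zero}             e = contradiction (≡-sym e) x≢z
triple-injective _   _   y≢z {suc (suc zero)}   {suc zero}         e = contradiction (≡-sym e) y≢z
triple-injective _   _   _   {suc (suc zero)}   {suc (suc zero)}   _ = refl

injective-members⇒≤length : {f : Fin k → A} {xs : List A} →
  Injective _≡_ _≡_ f → (∀ i → f i ∈ xs) → k ≤ length xs
injective-members⇒≤length {xs = xs} f-inj f∈xs = injective⇒≤ λ {i} {j} same-index →
  f-inj (trans (lookup-index (f∈xs i))
        (trans (cong (lookup xs) same-index) (≡-sym (lookup-index (f∈xs j)))))

least-witness : {P : ℕ → Set} → (∀ k → Dec (P k)) → P k →
  ∃[ d ] P d × (∀ j → P j → d ≤ j)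
least-witness {k = k} {P = P} P? = <-rec (λ k → P k → Least) search k
  where
  Least = ∃[ d ] P d × (∀ j → P j → d ≤ j)
  search : ∀ k → (∀ {j} → j < k → P j → Least) → P k → Least
  search k smaller Pk with anyUpTo? P? k
  ... | yes (j , j<k , Pj) = smaller j<k Pj
  ... | no none = k , Pk , λ j Pj → ≮⇒≥ λ j<k → none (j , j<k , Pj)

_▷_ : Walk R x y k → R y z → Walk R x z (suc k)
here ▷ r = step r here
step r′ p ▷ r = step r′ (p ▷ r)

reverse : Walk R x y k → Walk (flip R) y x k
reverse here = here
reverse (step r p) = reverse p ▷ r

first-arc : x ≢ y → Walk R x y k → ∃[ w ] R x w
first-arc x≢y here = contradiction refl x≢y
first-arc _ (step r _) = _ , r

last-arc : x ≢ y → Walk R x y k → ∃[ w ] R w y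
last-arc x≢y p = first-arc (x≢y ∘ ≡-sym) (reverse p)

walk? : (∀ x y → Dec (R x y)) → ∀ k x y → Dec (Walk R x y k)
walk? R? zero x y with x ≟ y
... | yes refl = yes here
... | no x≢y = no λ { here → x≢y refl }
walk? R? (suc k) x y with any? (λ w → R? x w ×-dec walk? R? k w y)
... | yes (w , r , p) = yes (step r p)
... | no ¬via = no λ { (step r p) → ¬via (_ , r , p) }

skip-forced-path : (∀ {w} → R x w → w ≡ y) → (∀ {w} → R y w → w ≡ z) →
  w ≢ x → w ≢ y → Walk R x w k → ∃[ j ] Walk R z w j × k ≡ 2 + j
skip-forced-path _ _ w≢x _ here = contradiction refl w≢x
skip-forced-path x-out y-out w≢x w≢y (step r p) with x-out r
skip-forced-path _ _ _ w≢y (step _ here) | refl = contradiction refl w≢y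
skip-forced-path _ y-out _ _ (step _ (step r p)) | refl with y-out r
... | refl = _ , p , refl

NeighboursAmong : Graph n → Fin n → Fin n → Fin n → Set
NeighboursAmong G x p q = ∀ {w} → Edge G x w → w ≡ p ⊎ w ≡ q

module _ (G : Graph n) where

  edge-sym : Edge G x y → Edge G y x
  edge-sym {x = x} {y} = subst T (Graph.sym G x y)

  edge⇒≢ : Edge G x y → x ≢ y
  edge⇒≢ {x = x} xx refl = subst T (irrefl G x) xx

  three-neighbours⇒3≤degree : Edge G x p → Edge G x q → Edge G x w →
    p ≢ q → p ≢ w → q ≢ w → 3 ≤ degree G x
  three-neighbours⇒3≤degree {x = x} {p} {q} {w} xp xq xw p≢q p≢w q≢w =
    injective-members⇒≤length (triple-injective p≢q p≢w q≢w) neighbour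
    where
    adjacent : ∀ i → Edge G x (triple p q w i)
    adjacent zero = xp
    adjacent (suc zero) = xq
    adjacent (suc (suc zero)) = xw
    neighbour : ∀ i → triple p q w i ∈ filter (λ y → T? (adj G x y)) (allFin n)
    neighbour i = ∈-filter⁺ (λ y → T? (adj G x y)) (∈-allFin _) (adjacent i)

  degree≡2⇒NeighboursAmong : degree G x ≡ 2 → Edge G x p → Edge G x q → p ≢ q →
    NeighboursAmong G x p q
  degree≡2⇒NeighboursAmong {p = p} {q} deg xp xq p≢q {w} xw with w ≟ p | w ≟ q
  ... | yes w≡p | _ = inj₁ w≡p
  ... | no _ | yes w≡q = inj₂ w≡q
  ... | no w≢p | no w≢q = contradiction
    (subst (3 ≤_) deg (three-neighbours⇒3≤degree xp xq xw p≢q (w≢p ∘ ≡-sym) (w≢q ∘ ≡-sym)))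
    (<-irrefl refl)

module _ {G : Graph n} (O : Orientation G) where

  arc-asym : Arc O x y → ¬ Arc O y x
  arc-asym = oneway O _ _

  arc⇒≢ : Arc O x y → x ≢ y
  arc⇒≢ = edge⇒≢ G ∘ arc⇒edge O _ _

  arc? : ∀ x y → Dec (Arc O x y)
  arc? x y = T? (arc O x y)

  in-arc-from : NeighboursAmong G x p q → Arc O x q → Arc O w x → w ≡ p
  in-arc-from nbrs xq wx with nbrs (edge-sym G (arc⇒edge O _ _ wx))
  ... | inj₁ w≡p = w≡p
  ... | inj₂ refl = contradiction wx (arc-asym xq)

  out-arc-to : NeighboursAmong G x p q → Arc O p x → Arc O x w → w ≡ q
  out-arc-to nbrs px xw with nbrs (arc⇒edge O _ _ xw)
  ... | inj₁ refl = contradiction xw (arc-asym px)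
  ... | inj₂ w≡q = w≡q

  2≤θ : x ≢ y → IsTheta O x y t → 2 ≤ t
  2≤θ x≢y (_ , _ , (xy , _) , (yx , _) , refl) = 2≤⊔ x≢y xy yx
    where
    2≤⊔ : ∀ {d₁ d₂} → x ≢ y → Walk (Arc O) x y d₁ → Walk (Arc O) y x d₂ → 2 ≤ d₁ ⊔ d₂
    2≤⊔ x≢x here _ = contradiction refl x≢x
    2≤⊔ x≢x _ here = contradiction refl x≢x
    2≤⊔ _ (step r here) (step r′ here) = contradiction r′ (arc-asym r)
    2≤⊔ {d₁ = d₁} {d₂ = d₂} _ (step _ (step _ _)) _ = ≤-trans (s≤s (s≤s z≤n)) (m≤m⊔n d₁ d₂)
    2≤⊔ {d₁ = d₁} {d₂ = d₂} _ (step _ here) (step _ (step _ _)) = ≤-trans (s≤s (s≤s z≤n)) (m≤n⊔m d₁ d₂)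

  module _ (strong : Strong O) where

    dist-exists : ∀ x y → ∃ (IsDist O x y)
    dist-exists x y = least-witness (λ k → walk? arc? k x y) (proj₂ (strong x y))

    θ-exists : ∀ x y → ∃ (IsTheta O x y)
    θ-exists x y with dist-exists x y | dist-exists y x
    ... | d₁ , xy | d₂ , yx = _ , d₁ , d₂ , xy , yx , refl

    dist≤diam : ∀ {m} → IsDiam O m → IsDist O x y d → d ≤ m
    dist≤diam {x = x} {y} {d} (_ , θ≤m) xy with dist-exists y x
    ... | d′ , yx = ≤-trans (m≤m⊔n d d′) (θ≤m x y _ (d , d′ , xy , yx , refl))

    arc-into : NeighboursAmong G x p q → Arc O x q → Arc O p x
    arc-into nbrs xq with last-arc (arc⇒≢ xq ∘ ≡-sym) (proj₂ (strong _ _))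
    ... | w , wx = subst (λ w → Arc O w _) (in-arc-from nbrs xq wx) wx

    arc-out-of : NeighboursAmong G x p q → Arc O p x → Arc O x q
    arc-out-of nbrs px with first-arc (arc⇒≢ px ∘ ≡-sym) (proj₂ (strong _ _))
    ... | w , xw = subst (Arc O _) (out-arc-to nbrs px xw) xw

record DirectedIsolatedTriangle {G : Graph n} (O : Orientation G) (v : Fin n) : Set where
  field
    a b : Fin n
    v→a : Arc O v a
    a→b : Arc O a b
    b→v : Arc O b v
    a-neighbours : NeighboursAmong G a v b
    b-neighbours : NeighboursAmong G b a v

isolated-triangle⇒directed : {G : Graph n} {O : Orientation G} → Strong O → ∀ {v} →
  IsolatedTriangleAt G v → DirectedIsolatedTriangle O v
isolated-triangle⇒directed {G = G} {O} strong {v} (v₁ , v₂ , deg₁ , deg₂ , vv₁ , v₁v₂ , vv₂) =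
  [ orient deg₁ deg₂ vv₁ v₁v₂ vv₂ , orient deg₂ deg₁ vv₂ (edge-sym G v₁v₂) vv₁ ]′
    (covers O v₁ v₂ v₁v₂)
  where
  orient : ∀ {a b} → degree G a ≡ 2 → degree G b ≡ 2 →
    Edge G v a → Edge G a b → Edge G v b → Arc O a b → DirectedIsolatedTriangle O v
  orient {a} {b} deg-a deg-b va ab vb a→b = record
    { a = a ; b = b ; v→a = arc-into O strong a-nbrs a→b ; a→b = a→b
    ; b→v = arc-out-of O strong b-nbrs a→b
    ; a-neighbours = a-nbrs ; b-neighbours = b-nbrs }
    where
    a-nbrs : NeighboursAmong G a v b
    a-nbrs = degree≡2⇒NeighboursAmong G deg-a (edge-sym G va) ab (edge⇒≢ G vb)
    b-nbrs : NeighboursAmong G b a v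
    b-nbrs = degree≡2⇒NeighboursAmong G deg-b (edge-sym G ab) (edge-sym G vb)
      (edge⇒≢ G va ∘ ≡-sym)

module _ {G : Graph n} {O : Orientation G} (strong : Strong O) {v : Fin n}
         (C : DirectedIsolatedTriangle O v) {m : ℕ} (diam : IsDiam O m) where

  open DirectedIsolatedTriangle C

  2+∂-from-v≤diam : z ≢ a → z ≢ b → IsDist O v z d → 2 + d ≤ m
  2+∂-from-v≤diam {z = z} z≢a z≢b (_ , minimal) with dist-exists O strong a z
  ... | _ , az@(az-walk , _)
    with skip-forced-path (out-arc-to O a-neighbours v→a) (out-arc-to O b-neighbours a→b)
                          z≢a z≢b az-walk
  ... | j , vz , refl = ≤-trans (s≤s (s≤s (minimal j vz))) (dist≤diam O strong diam az)

  2+∂-to-v≤diam : z ≢ a → z ≢ b → IsDist O z v d → 2 + d ≤ m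
  2+∂-to-v≤diam {z = z} z≢a z≢b (_ , minimal) with dist-exists O strong z b
  ... | _ , zb@(zb-walk , _)
    with skip-forced-path (in-arc-from O b-neighbours b→v) (in-arc-from O a-neighbours a→b)
                          z≢b z≢a (reverse zb-walk)
  ... | j , vz , refl = ≤-trans (s≤s (s≤s (minimal j (reverse vz)))) (dist≤diam O strong diam zb)

  2+θ≤diam : z ≢ a → z ≢ b → IsTheta O z v t → 2 + t ≤ m
  2+θ≤diam z≢a z≢b (_ , _ , zv , vz , refl) =
    ⊔-lub (2+∂-to-v≤diam z≢a z≢b zv) (2+∂-from-v≤diam z≢a z≢b vz)

  θ[a,v]≤2 : IsTheta O a v t → t ≤ 2
  θ[a,v]≤2 (_ , _ , (_ , av-minimal) , (_ , va-minimal) , refl) =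
    ⊔-lub (av-minimal 2 (step a→b (step b→v here)))
          (≤-trans (va-minimal 1 (step v→a here)) (s≤s z≤n))

  θ[b,v]≤2 : IsTheta O b v t → t ≤ 2
  θ[b,v]≤2 (_ , _ , (_ , bv-minimal) , (_ , vb-minimal) , refl) =
    ⊔-lub (≤-trans (bv-minimal 1 (step b→v here)) (s≤s z≤n))
          (vb-minimal 2 (step v→a (step a→b here)))

  covered⇒triangle : (∀ x → x ∈ v ∷ a ∷ b ∷ []) → IsTriangle G
  covered⇒triangle covered =
    ≤-antisym (injective-members⇒≤length id covered)
              (injective⇒≤ (triple-injective (arc⇒≢ O v→a) (arc⇒≢ O b→v ∘ ≡-sym) (arc⇒≢ O a→b))) ,
    λ x y → edge-between (covered x) (covered y)
    where
    edge-between : x ∈ v ∷ a ∷ b ∷ [] → y ∈ v ∷ a ∷ b ∷ [] → x ≢ y → Edge G x y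
    edge-between (here refl)                 (here refl)                 x≢x = contradiction refl x≢x
    edge-between (here refl)                 (there (here refl))         _   = arc⇒edge O _ _ v→a
    edge-between (here refl)                 (there (there (here refl))) _   = edge-sym G (arc⇒edge O _ _ b→v)
    edge-between (there (here refl))         (here refl)                 _   = edge-sym G (arc⇒edge O _ _ v→a)
    edge-between (there (here refl))         (there (here refl))         x≢x = contradiction refl x≢x
    edge-between (there (here refl))         (there (there (here refl))) _   = arc⇒edge O _ _ a→b
    edge-between (there (there (here refl))) (here refl)                 _   = arc⇒edge O _ _ b→v
    edge-between (there (there (here refl))) (there (here refl))         _   = edge-sym G (arc⇒edge O _ _ a→b)
    edge-between (there (there (here refl))) (there (there (here refl))) x≢x = contradiction refl x≢x
    edge-between (there (there (there ())))  _                           _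
    edge-between _                           (there (there (there ())))  _

  outside-vertex : ¬ IsTriangle G → ∃[ z ] z ∉ v ∷ a ∷ b ∷ []
  outside-vertex ¬triangle with any? (λ z → ¬? (Any.any? (z ≟_) (v ∷ a ∷ b ∷ [])))
  ... | yes outside = outside
  ... | no ¬outside = contradiction
    (covered⇒triangle λ z → decidable-stable (Any.any? (z ≟_) _) λ z∉ → ¬outside (z , z∉))
    ¬triangle

  4≤diam : ¬ IsTriangle G → 4 ≤ m
  4≤diam ¬triangle with outside-vertex ¬triangle
  ... | z , z∉ with θ-exists O strong z v
  ... | _ , θ = ≤-trans (s≤s (s≤s (2≤θ O (z∉ ∘ here) θ)))
                        (2+θ≤diam (z∉ ∘ there ∘ here) (z∉ ∘ there ∘ there ∘ here) θ)

  θ+2≤diam : ¬ IsTriangle G → ∀ u → IsTheta O u v t → t + 2 ≤ m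
  θ+2≤diam ¬triangle u θ with u ≟ a | u ≟ b
  ... | yes refl | _        = ≤-trans (+-monoˡ-≤ 2 (θ[a,v]≤2 θ)) (4≤diam ¬triangle)
  ... | no _     | yes refl = ≤-trans (+-monoˡ-≤ 2 (θ[b,v]≤2 θ)) (4≤diam ¬triangle)
  ... | no u≢a   | no u≢b   = subst (_≤ m) (+-comm 2 _) (2+θ≤diam u≢a u≢b θ)

lemma2p1 : ∀ {n} (G : Graph n) (D : Fin n → Set) → Standard G D →
    (O : Orientation G) → Strong O → ¬ IsTriangle G →
    ∀ (m : ℕ) → IsDiam O m →
    ∀ (u v : Fin n) → ¬ D u → D v →
    ∀ (t : ℕ) → IsTheta O u v t → t + 2 ≤ m
lemma2p1 G D (_ , _ , _ , _ , _ , isolated-triangle) O strong ¬triangle m diam u v _ v∈D t θ =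
  θ+2≤diam {O = O} strong (isolated-triangle⇒directed {O = O} strong (isolated-triangle v v∈D))
    diam ¬triangle u θ
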